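{- Let $(W_r)_{r\in\mathbb{Z}}$ be a generalized Tribonacci sequence. For every integer $r$, \[ 252W_r^2 - 927W_{r - 1}^2 + 2884W_{r - 4}^2 - W_{r - 17}^2= 0 \] and \[ W_r^2 - 2W_{r - 1}^2 - 3W_{r - 2}^2 - 6W_{r - 3}^2 + W_{r - 4}^2 + W_{r - 6}^2 = 0. \]
   Context: Let $W_0,W_1,W_2$ be arbitrary integers, not all zero. The generalized Tribonacci numbers $(W_r)_{r\in\mathbb{Z}}$ are defined by $W_r=W_{r-1}+W_{r-2}+W_{r-3}$ for $r\ge 3$, and extended to negative indices by $W_{ -r}=W_{ -r+3}-W_{ -r+2}-W_{ -r+1}$ (so the recurrence holds for all $r\in\mathbb{Z}$). -}

module Defs where

open import Data.Integer using (ℤ; _+_; _-_)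
open import Relation.Binary.PropositionalEquality using (_≡_)

IsTribonacci : (ℤ → ℤ) → Set
IsTribonacci W = ∀ (r : ℤ) → W r ≡ W (r - Data.Integer.+ 1) + W (r - Data.Integer.+ 2) + W (r - Data.Integer.+ 3)

-- Every integer Tribonacci sequence is determined by three consecutive terms a, b, c and is
-- linear in them, so W r, W (r − 1), …, W (r − 17) are explicit integer linear forms in
-- a = W (r − 17), b = W (r − 16), c = W (r − 15). Each of the two relations then becomes a
-- quadratic form in a, b, c whose coefficients all vanish.
module Submission where

open import Defs
open import Data.Integer using (ℤ; +_; -_; _+_; _-_; _*_; 0ℤ; 1ℤ)
open import Data.Integer.Properties using (+-assoc; +-identityʳ)
open import Data.Integer.Tactic.RingSolver using (solve-∀)
open import Data.Nat using (ℕ; zero; suc)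
import Data.Nat as ℕ
open import Data.Product using (_×_; _,_)
open import Relation.Nullary using (¬_)
open import Relation.Binary.PropositionalEquality
  using (_≡_; refl; sym; trans; cong; cong₂; module ≡-Reasoning)

open ≡-Reasoning

trib : ℤ → ℤ → ℤ → ℕ → ℤ
trib a b c zero    = a
trib a b c (suc n) = trib b c (c + b + a) n

trib-linear : ∀ a b c n →
  trib a b c n ≡ a * trib 1ℤ 0ℤ 0ℤ n + b * trib 0ℤ 1ℤ 0ℤ n + c * trib 0ℤ 0ℤ 1ℤ n
trib-linear a b c zero = unit a b c
  where
  unit : ∀ a b c → a ≡ a * 1ℤ + b * 0ℤ + c * 0ℤ
  unit = solve-∀
trib-linear a b c (suc n) = begin
  trib b c (c + b + a) n
    ≡⟨ trib-linear b c (c + b + a) n ⟩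
  b * A + c * B + (c + b + a) * C
    ≡⟨ regroup a b c A B C ⟩
  a * (0ℤ * A + 0ℤ * B + 1ℤ * C) + b * (1ℤ * A + 0ℤ * B + 1ℤ * C) + c * (0ℤ * A + 1ℤ * B + 1ℤ * C)
    ≡⟨ sym (cong₂ _+_ (cong₂ _+_ (cong (a *_) (trib-linear 0ℤ 0ℤ 1ℤ n))
                                 (cong (b *_) (trib-linear 1ℤ 0ℤ 1ℤ n)))
                      (cong (c *_) (trib-linear 0ℤ 1ℤ 1ℤ n))) ⟩
  a * trib 0ℤ 0ℤ 1ℤ n + b * trib 1ℤ 0ℤ 1ℤ n + c * trib 0ℤ 1ℤ 1ℤ n
    ∎
  where
  A = trib 1ℤ 0ℤ 0ℤ n
  B = trib 0ℤ 1ℤ 0ℤ n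
  C = trib 0ℤ 0ℤ 1ℤ n
  regroup : ∀ a b c A B C → b * A + c * B + (c + b + a) * C
          ≡ a * (0ℤ * A + 0ℤ * B + 1ℤ * C) + b * (1ℤ * A + 0ℤ * B + 1ℤ * C)
            + c * (0ℤ * A + 1ℤ * B + 1ℤ * C)
  regroup = solve-∀

module _ {W : ℤ → ℤ} (tribonacci : IsTribonacci W) where

  W-+3 : ∀ s → W (s + + 3) ≡ W (s + + 2) + W (s + + 1) + W s
  W-+3 s = begin
    W (s + + 3)
      ≡⟨ tribonacci (s + + 3) ⟩
    W (s + + 3 - + 1) + W (s + + 3 - + 2) + W (s + + 3 - + 3)
      ≡⟨ cong₂ _+_ (cong₂ _+_ (cong W (+-assoc s (+ 3) (- + 1)))
                              (cong W (+-assoc s (+ 3) (- + 2))))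
                   (cong W (trans (+-assoc s (+ 3) (- + 3)) (+-identityʳ s))) ⟩
    W (s + + 2) + W (s + + 1) + W s
      ∎

  W-from : ∀ n s → W (s + + n) ≡ trib (W s) (W (s + + 1)) (W (s + + 2)) n
  W-from zero s = cong W (+-identityʳ s)
  W-from (suc n) s = begin
    W (s + + suc n)
      ≡⟨ cong W (sym (+-assoc s (+ 1) (+ n))) ⟩
    W (s + + 1 + + n)
      ≡⟨ W-from n (s + + 1) ⟩
    trib (W (s + + 1)) (W (s + + 1 + + 1)) (W (s + + 1 + + 2)) n
      ≡⟨ cong₂ (λ y z → trib (W (s + + 1)) y z n)
               (cong W (+-assoc s (+ 1) (+ 1)))
               (trans (cong W (+-assoc s (+ 1) (+ 2))) (W-+3 s)) ⟩
    trib (W (s + + 1)) (W (s + + 2)) (W (s + + 2) + W (s + + 1) + W s) n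
      ∎

  W-lookback : ∀ r m k → let s = r - + (m ℕ.+ k) in
    W (r - + k) ≡ W s * trib 1ℤ 0ℤ 0ℤ m + W (s + + 1) * trib 0ℤ 1ℤ 0ℤ m
                  + W (s + + 2) * trib 0ℤ 0ℤ 1ℤ m
  W-lookback r m k = begin
    W (r - + k)
      ≡⟨ cong W (back r (+ m) (+ k)) ⟩
    W (s + + m)
      ≡⟨ W-from m s ⟩
    trib (W s) (W (s + + 1)) (W (s + + 2)) m
      ≡⟨ trib-linear (W s) (W (s + + 1)) (W (s + + 2)) m ⟩
    _ ∎
    where
    s : ℤ
    s = r - + (m ℕ.+ k)
    back : ∀ r x y → r - y ≡ r - (x + y) + x
    back = solve-∀

-- The coefficients of x_k are trib 1ℤ 0ℤ 0ℤ m, trib 0ℤ 1ℤ 0ℤ m and trib 0ℤ 0ℤ 1ℤ m with m = 17 − k.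
first-identity : ∀ a b c {x₀ x₁ x₄} →
  x₀ ≡ a * + 3136 + b * + 4841 + c * + 5768 →
  x₁ ≡ a * + 1705 + b * + 2632 + c * + 3136 →
  x₄ ≡ a * + 274 + b * + 423 + c * + 504 →
  + 252 * (x₀ * x₀) - + 927 * (x₁ * x₁) + + 2884 * (x₄ * x₄) - a * a ≡ 0ℤ
first-identity a b c refl refl refl = quadratic-form a b c
  where
  quadratic-form : ∀ a b c →
    + 252 * ((a * + 3136 + b * + 4841 + c * + 5768) * (a * + 3136 + b * + 4841 + c * + 5768))
    - + 927 * ((a * + 1705 + b * + 2632 + c * + 3136) * (a * + 1705 + b * + 2632 + c * + 3136))
    + + 2884 * ((a * + 274 + b * + 423 + c * + 504) * (a * + 274 + b * + 423 + c * + 504))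
    - a * a ≡ 0ℤ
  quadratic-form = solve-∀

second-identity : ∀ a b c {x₀ x₁ x₂ x₃ x₄ x₆} →
  x₀ ≡ a * + 3136 + b * + 4841 + c * + 5768 →
  x₁ ≡ a * + 1705 + b * + 2632 + c * + 3136 →
  x₂ ≡ a * + 927 + b * + 1431 + c * + 1705 →
  x₃ ≡ a * + 504 + b * + 778 + c * + 927 →
  x₄ ≡ a * + 274 + b * + 423 + c * + 504 →
  x₆ ≡ a * + 81 + b * + 125 + c * + 149 →
  x₀ * x₀ - + 2 * (x₁ * x₁) - + 3 * (x₂ * x₂) - + 6 * (x₃ * x₃) + x₄ * x₄ + x₆ * x₆ ≡ 0ℤ
second-identity a b c refl refl refl refl refl refl = quadratic-form a b c
  where
  quadratic-form : ∀ a b c →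
    (a * + 3136 + b * + 4841 + c * + 5768) * (a * + 3136 + b * + 4841 + c * + 5768)
    - + 2 * ((a * + 1705 + b * + 2632 + c * + 3136) * (a * + 1705 + b * + 2632 + c * + 3136))
    - + 3 * ((a * + 927 + b * + 1431 + c * + 1705) * (a * + 927 + b * + 1431 + c * + 1705))
    - + 6 * ((a * + 504 + b * + 778 + c * + 927) * (a * + 504 + b * + 778 + c * + 927))
    + (a * + 274 + b * + 423 + c * + 504) * (a * + 274 + b * + 423 + c * + 504)
    + (a * + 81 + b * + 125 + c * + 149) * (a * + 81 + b * + 125 + c * + 149) ≡ 0ℤ
  quadratic-form = solve-∀

theorem5 : (W : ℤ → ℤ) → IsTribonacci W
             → ¬ (W 0ℤ ≡ 0ℤ × W (+ 1) ≡ 0ℤ × W (+ 2) ≡ 0ℤ)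
             → ∀ (r : ℤ)
             → ((+ 252) * (W r * W r) - (+ 927) * (W (r - + 1) * W (r - + 1))
                 + (+ 2884) * (W (r - + 4) * W (r - + 4)) - W (r - + 17) * W (r - + 17) ≡ 0ℤ)
               × (W r * W r - (+ 2) * (W (r - + 1) * W (r - + 1)) - (+ 3) * (W (r - + 2) * W (r - + 2))
                 - (+ 6) * (W (r - + 3) * W (r - + 3)) + W (r - + 4) * W (r - + 4)
                 + W (r - + 6) * W (r - + 6) ≡ 0ℤ)
theorem5 W tribonacci _ r =
    first-identity  (W s) (W (s + + 1)) (W (s + + 2)) W-r (at 16 1) (at 13 4)
  , second-identity (W s) (W (s + + 1)) (W (s + + 2)) W-r (at 16 1) (at 15 2) (at 14 3) (at 13 4) (at 11 6)
  where
  s : ℤ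
  s = r - + 17
  at : ∀ m k → W (r - + k) ≡ W (r - + (m ℕ.+ k)) * trib 1ℤ 0ℤ 0ℤ m
                 + W (r - + (m ℕ.+ k) + + 1) * trib 0ℤ 1ℤ 0ℤ m + W (r - + (m ℕ.+ k) + + 2) * trib 0ℤ 0ℤ 1ℤ m
  at = W-lookback tribonacci r
  W-r : W r ≡ W s * + 3136 + W (s + + 1) * + 4841 + W (s + + 2) * + 5768
  W-r = trans (cong W (sym (+-identityʳ r))) (at 17 0)
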